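{- Let $G$ be a graph whose Boolean dimension is finite. Then $\dim_{Bool}(G)$ equals the inner dimension of $G$, and exactly one of the following holds: (1) $\dim_{geo}(G)=\dim_{symp}(G)=\dim_{Bool}(G)$; (2) $\dim_{geo}(G)=\dim_{symp}(G)=\dim_{Bool}(G)-1$; (3) $\dim_{geo}(G)=\dim_{Bool}(G)<\dim_{symp}(G)$. Moreover, in case (3) the difference $\dim_{symp}(G)-\dim_{Bool}(G)$ can be arbitrarily large (i.e. for every $N$ there is a graph in case (3) with $\dim_{symp}(G)-\dim_{Bool}(G)\ge N$).
   Context: All vector spaces are over $\mathbb{F}_2$. The Boolean dimension $\dim_{Bool}(G)$ is the least cardinal $\kappa$ such that there is a family of $\kappa$ subsets $C_i\subseteq V(G)$ such that a pair of distinct vertices is an edge of $G$ iff it is contained in a finite and odd number of the $C_i$. For a vector space $U$ with symmetric bilinear form $\varphi$, a map $f:V(G)\to U$ is a geometric representation of $G$ if for all distinct $u,v$, $u\sim v$ iff $\varphi(f(u),f(v))\neq0$. $\dim_{geo}(G)$ is the least dimension of a space with a symmetric bilinear form in which $G$ has a geometric representation; $\dim_{symp}(G)$ is the least such dimension when $\varphi$ is required to be alternating ($\varphi(x,x)=0$ for all $x$); the inner dimension is the least such dimension when $\varphi$ is required to be a scalar product (the space has a basis of pairwise orthogonal vectors $e$ with $\varphi(e,e)\neq0$). -}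

module Defs where

open import Level using (0ℓ)
open import Data.Bool using (Bool; true; false; _xor_; _∧_)
open import Data.Nat using (ℕ; zero; suc; _<_; _≤_; _+_)
open import Data.Fin using (Fin; zero; suc)
open import Data.Vec using (Vec; []; _∷_; zipWith; replicate; lookup)
open import Data.Product using (Σ; _×_; _,_; ∃)
open import Data.Sum using (_⊎_)
open import Relation.Binary.PropositionalEquality using (_≡_; _≢_)
open import Relation.Nullary using (¬_)
open import Function.Bundles using (_⇔_)

record Graph : Set₁ where
  field
    V     : Set
    E     : V → V → Set
    sym   : ∀ {u v} → E u v → E v u
    irrefl : ∀ {u} → ¬ E u u

open Graph public

-- F₂ arithmetic: Bool with xor as + and ∧ as *.

parity : ∀ {n} → (Fin n → Bool) → Bool
parity {zero}  f = false
parity {suc n} f = f zero xor parity (λ i → f (suc i))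

-- Boolean representation with n sets C₀ … C_{n-1} ⊆ V
-- (subsets given by their characteristic functions):
-- distinct u v adjacent iff {u,v} lies in an odd number of the C_i.

HasBoolRep : Graph → ℕ → Set
HasBoolRep G n =
  Σ (Fin n → V G → Bool) λ C →
    ∀ (u v : V G) → u ≢ v →
      (E G u v ⇔ (parity (λ i → C i u ∧ C i v) ≡ true))

IsBoolDim : Graph → ℕ → Set
IsBoolDim G n = HasBoolRep G n × (∀ m → m < n → ¬ HasBoolRep G m)

-- The d-dimensional F₂-vector space F₂^d (every d-dimensional space is
-- isomorphic to it) and symmetric bilinear forms on it.

Vect : ℕ → Set
Vect d = Vec Bool d

_⊕_ : ∀ {d} → Vect d → Vect d → Vect d
x ⊕ y = zipWith _xor_ x y

_·_ : ∀ {d} → Bool → Vect d → Vect d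
c · x = Data.Vec.map (c ∧_) x

𝟘 : ∀ {d} → Vect d
𝟘 = replicate _ false

lincomb : ∀ {n d} → (Fin n → Bool) → (Fin n → Vect d) → Vect d
lincomb {zero}  c e = 𝟘
lincomb {suc n} c e = (c zero · e zero) ⊕ lincomb (λ i → c (suc i)) (λ i → e (suc i))

-- A symmetric bilinear form on F₂^d (over F₂, bilinearity = biadditivity
-- together with compatibility with the scalars 0,1).
record SymBilinear (d : ℕ) : Set where
  field
    φ      : Vect d → Vect d → Bool
    addˡ   : ∀ x y z → φ (x ⊕ y) z ≡ (φ x z xor φ y z)
    scalˡ  : ∀ c x z → φ (c · x) z ≡ (c ∧ φ x z)
    symm   : ∀ x y → φ x y ≡ φ y x

open SymBilinear public

Alternating : ∀ {d} → SymBilinear d → Set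
Alternating B = ∀ x → φ B x x ≡ false

IsBasis : ∀ {d} → (Fin d → Vect d) → Set
IsBasis {d} e =
  (∀ (x : Vect d) → ∃ λ (c : Fin d → Bool) → lincomb c e ≡ x) ×
  (∀ (c : Fin d → Bool) → lincomb c e ≡ 𝟘 → ∀ i → c i ≡ false)

ScalarProduct : ∀ {d} → SymBilinear d → Set
ScalarProduct {d} B =
  Σ (Fin d → Vect d) λ e →
    IsBasis e ×
    (∀ i j → i ≢ j → φ B (e i) (e j) ≡ false) ×
    (∀ i → φ B (e i) (e i) ≡ true)

GeoRep : (G : Graph) → ∀ {d} → SymBilinear d → (V G → Vect d) → Set
GeoRep G B f = ∀ (u v : V G) → u ≢ v → (E G u v ⇔ (φ B (f u) (f v) ≡ true))

HasGeoRep : Graph → ℕ → Set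
HasGeoRep G d = Σ (SymBilinear d) λ B → Σ (V G → Vect d) λ f → GeoRep G B f

HasSympRep : Graph → ℕ → Set
HasSympRep G d =
  Σ (SymBilinear d) λ B → Alternating B × Σ (V G → Vect d) λ f → GeoRep G B f

HasInnerRep : Graph → ℕ → Set
HasInnerRep G d =
  Σ (SymBilinear d) λ B → ScalarProduct B × Σ (V G → Vect d) λ f → GeoRep G B f

Least : (ℕ → Set) → ℕ → Set
Least P d = P d × (∀ m → m < d → ¬ P m)

IsGeoDim IsSympDim IsInnerDim : Graph → ℕ → Set
IsGeoDim   G = Least (HasGeoRep G)
IsSympDim  G = Least (HasSympRep G)
IsInnerDim G = Least (HasInnerRep G)

-- The three cases, for dim_Bool(G) = n

Case1 Case2 Case3 : Graph → ℕ → Set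
Case1 G n = IsGeoDim G n × IsSympDim G n
Case2 G n = Σ ℕ λ m → suc m ≡ n × IsGeoDim G m × IsSympDim G m
-- dim_geo = dim_Bool < dim_symp  (dim_symp may be infinite)
Case3 G n = IsGeoDim G n × (∀ m → m ≤ n → ¬ HasSympRep G m)

ExactlyOneOf : Set → Set → Set → Set
ExactlyOneOf A B C =
  (A ⊎ B ⊎ C) × ¬ (A × B) × ¬ (A × C) × ¬ (B × C)

-- A family of n sets C₁ … Cₙ is the same as the map u ↦ (C₁(u), …, Cₙ(u)) into F₂ⁿ, and u, v lie in an
-- odd number of common sets iff their images have dot product 1. The dot product is a scalar product, and
-- conversely coordinates in an orthonormal basis turn any scalar product into it: dim_Bool = dim_inner.
--
-- Every symmetric F₂-matrix of size d is the Gram matrix, under the dot product, of d vectors in F₂^(d+1),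
-- and even in F₂^d when some diagonal entry is 1. One splits off either a pivot vector u with u·u = 1 or a
-- hyperbolic pair and recurses on the Schur complement; an alternating complement is realized orthogonally
-- to the all-ones vector 𝟙, which has 𝟙·𝟙 = 1 in odd dimension and can then serve as the pivot. Applied to
-- the Gram matrix of a form this gives dim_Bool ≤ dim_geo + 1, and dim_Bool ≤ d for any representation in
-- dimension d whose form is not alternating. With excluded middle the three cases follow.
--
-- In the complete graph on 2k vertices one set suffices, while the vectors of a symplectic representation
-- have Gram matrix J − I, which is invertible since 2k is even; so dim_symp = 2k and dim_Bool = dim_geo = 1.

module Submission where

open import Defs
open import Level using (0ℓ)
open import Axiom.ExcludedMiddle using (ExcludedMiddle)
open import Data.Nat using (ℕ; zero; suc; _+_; _*_; _^_; _≤_; _<_; z≤n; s≤s; _≤′_; ≤′-refl; ≤′-step)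
open import Data.Nat.Properties
  using (≤⇒≤′; ≤-refl; ≤-trans; ≤-antisym; ≤-pred; n≤1+n; ≮⇒≥; <⇒≱; m≤n⇒m<n∨m≡n; m≤m*n; ^-monoʳ-<)
open import Data.Product using (Σ; _×_; _,_; proj₁; proj₂; ∃; uncurry)
open import Data.Bool using (Bool; true; false; not; _xor_; _∧_)
import Data.Bool as Bool
open import Data.Bool.Properties
  using (xor-identityʳ; xor-same; ∧-assoc; ∧-comm; ∧-idem; ∧-identityʳ; ∧-zeroʳ;
         ∧-distribˡ-xor; ∧-distribʳ-xor; ¬-not)
open import Data.Bool.Solver using (module xor-∧-Solver)
open import Data.Fin using (Fin; zero; suc; _≟_)
open import Data.Fin.Properties using (suc-injective; any?; injective⇒≤; *↔×; 2↔Bool)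
open import Data.Fin.Permutation.Components using (transpose; transpose-inverse)
open import Data.Vec using (Vec; []; _∷_; lookup; tabulate; replicate; uncons)
open import Data.Vec.Properties
  using (lookup-zipWith; lookup-map; lookup-replicate; map-replicate;
         lookup∘tabulate; tabulate∘lookup; tabulate-cong)
open import Data.Product.Function.NonDependent.Propositional using (_×-↔_)
open import Data.Sum using (_⊎_; inj₁; inj₂; [_,_]′)
open import Function using (_∘_; id)
open import Function.Bundles using (_↔_; _↣_; _⇔_; mk↔ₛ′; mk↣; mk⇔; Injection; Equivalence)
open import Function.Construct.Composition using (_↔-∘_; _↣-∘_)
open import Function.Properties.Inverse using (↔-sym; ↔⇒↣)
open import Relation.Binary.PropositionalEquality
  using (_≡_; _≢_; refl; trans; cong; cong₂; subst; module ≡-Reasoning)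
import Relation.Binary.PropositionalEquality as ≡
open import Relation.Nullary using (¬_; does; yes; no; contradiction)
open import Relation.Nullary.Decidable using (dec-true; dec-false)

open xor-∧-Solver using (solve; _:=_; _:+_; _:*_; con)

-- Parity and the dot product on F₂^d

parity-cong : ∀ {n} {f g : Fin n → Bool} → (∀ i → f i ≡ g i) → parity f ≡ parity g
parity-cong {zero}  f≗g = refl
parity-cong {suc n} f≗g = cong₂ _xor_ (f≗g zero) (parity-cong (f≗g ∘ suc))

parity-false : ∀ {n} {f : Fin n → Bool} → (∀ i → f i ≡ false) → parity f ≡ false
parity-false {zero}  f≡0 = refl
parity-false {suc n} f≡0 rewrite f≡0 zero = parity-false (f≡0 ∘ suc)

parity-xor : ∀ {n} (f g : Fin n → Bool) →
             parity (λ i → f i xor g i) ≡ parity f xor parity g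
parity-xor {zero}  f g = refl
parity-xor {suc n} f g =
  trans (cong ((f zero xor g zero) xor_) (parity-xor (f ∘ suc) (g ∘ suc)))
        (solve 4 (λ a b p q → (a :+ b) :+ (p :+ q) := (a :+ p) :+ (b :+ q)) refl
               (f zero) (g zero) (parity (f ∘ suc)) (parity (g ∘ suc)))

∧-parity : ∀ {n} c (f : Fin n → Bool) → c ∧ parity f ≡ parity (λ i → c ∧ f i)
∧-parity {zero}  c     f = ∧-zeroʳ c
∧-parity {suc n} c     f =
  trans (∧-distribˡ-xor c (f zero) (parity (f ∘ suc))) (cong (c ∧ f zero xor_) (∧-parity c (f ∘ suc)))

parity-single : ∀ {n} (f : Fin n → Bool) k → (∀ i → i ≢ k → f i ≡ false) → parity f ≡ f k
parity-single {suc n} f zero    off =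
  trans (cong (f zero xor_) (parity-false (λ i → off (suc i) λ ()))) (xor-identityʳ (f zero))
parity-single {suc n} f (suc k) off rewrite off zero (λ ()) =
  parity-single (f ∘ suc) k (λ i i≢k → off (suc i) (i≢k ∘ suc-injective))

parity-δ : ∀ {n} (f δ : Fin n → Bool) k → δ k ≡ true → (∀ i → i ≢ k → δ i ≡ false) →
           parity (λ i → f i ∧ δ i) ≡ f k
parity-δ f δ k δk off =
  trans (parity-single _ k (λ i i≢k → trans (cong (f i ∧_) (off i i≢k)) (∧-zeroʳ (f i))))
        (trans (cong (f k ∧_) δk) (∧-identityʳ (f k)))

parity-even : ∀ k b → parity {k * 2} (λ _ → b) ≡ false
parity-even zero    b     = refl
parity-even (suc k) false = parity-even k false
parity-even (suc k) true  rewrite parity-even k true = refl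

∃true⊎∀false : ∀ {n} (f : Fin n → Bool) → (∃ λ i → f i ≡ true) ⊎ (∀ i → f i ≡ false)
∃true⊎∀false f with any? (λ i → f i Bool.≟ true)
... | yes fi≡true = inj₁ fi≡true
... | no  ¬fi≡true = inj₂ (λ i → ¬-not (λ fi≡true → ¬fi≡true (i , fi≡true)))

dot : ∀ {d} → Vect d → Vect d → Bool
dot x y = parity (λ k → lookup x k ∧ lookup y k)

dot-comm : ∀ {d} (x y : Vect d) → dot x y ≡ dot y x
dot-comm x y = parity-cong (λ k → ∧-comm (lookup x k) (lookup y k))

dot-⊕ˡ : ∀ {d} (x y z : Vect d) → dot (x ⊕ y) z ≡ dot x z xor dot y z
dot-⊕ˡ x y z =
  trans (parity-cong expand) (parity-xor (λ k → lookup x k ∧ lookup z k) (λ k → lookup y k ∧ lookup z k))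
  where
  expand : ∀ k → lookup (x ⊕ y) k ∧ lookup z k ≡ (lookup x k ∧ lookup z k) xor (lookup y k ∧ lookup z k)
  expand k = trans (cong (_∧ lookup z k) (lookup-zipWith _xor_ k x y))
                   (∧-distribʳ-xor (lookup z k) (lookup x k) (lookup y k))

dot-·ˡ : ∀ {d} c (x z : Vect d) → dot (c · x) z ≡ c ∧ dot x z
dot-·ˡ c x z = trans (parity-cong expand) (≡.sym (∧-parity c (λ k → lookup x k ∧ lookup z k)))
  where
  expand : ∀ k → lookup (c · x) k ∧ lookup z k ≡ c ∧ (lookup x k ∧ lookup z k)
  expand k = trans (cong (_∧ lookup z k) (lookup-map k (c ∧_) x)) (∧-assoc c (lookup x k) (lookup z k))

dotForm : ∀ d → SymBilinear d
dotForm d = record { φ = dot ; addˡ = dot-⊕ˡ ; scalˡ = dot-·ˡ ; symm = dot-comm }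

𝟙 : ∀ {d} → Vect d
𝟙 = replicate _ true

dot-𝟙ʳ : ∀ {d} (x : Vect d) → dot x 𝟙 ≡ dot x x
dot-𝟙ʳ x = parity-cong λ k →
  trans (cong (lookup x k ∧_) (lookup-replicate k true))
        (trans (∧-identityʳ (lookup x k)) (≡.sym (∧-idem (lookup x k))))

dot-𝟘ʳ : ∀ {d} (x : Vect d) → dot x 𝟘 ≡ false
dot-𝟘ʳ x = parity-false λ k →
  trans (cong (lookup x k ∧_) (lookup-replicate k false)) (∧-zeroʳ (lookup x k))

dot-tabulate : ∀ {d} (a b : Fin d → Bool) → dot (tabulate a) (tabulate b) ≡ parity (λ i → a i ∧ b i)
dot-tabulate a b = parity-cong (λ i → cong₂ _∧_ (lookup∘tabulate a i) (lookup∘tabulate b i))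

lookup-ext : ∀ {d} {x y : Vect d} → (∀ k → lookup x k ≡ lookup y k) → x ≡ y
lookup-ext {x = x} {y} x≗y =
  trans (≡.sym (tabulate∘lookup x)) (trans (tabulate-cong x≗y) (tabulate∘lookup y))

ε : ∀ {d} → Fin d → Vect d
ε i = tabulate (λ k → does (k ≟ i))

dot-ε : ∀ {d} (x : Vect d) i → dot x (ε i) ≡ lookup x i
dot-ε x i = trans (parity-cong (λ k → cong (lookup x k ∧_) (lookup∘tabulate _ k)))
                  (parity-δ (lookup x) _ i (dec-true (i ≟ i) refl) (λ k k≢i → dec-false (k ≟ i) k≢i))

IsLinear : ∀ {d} → (Vect d → Bool) → Set
IsLinear L = (∀ x y → L (x ⊕ y) ≡ L x xor L y) × (∀ c x → L (c · x) ≡ c ∧ L x)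

linear-lincomb : ∀ {d} {L : Vect d → Bool} → IsLinear L →
                 ∀ {n} (c : Fin n → Bool) (e : Fin n → Vect d) →
                 L (lincomb c e) ≡ parity (λ i → c i ∧ L (e i))
linear-lincomb {d} {L} (_ , scal) {zero} c e =
  trans (cong L (≡.sym (map-replicate (false ∧_) false d))) (scal false 𝟘)
linear-lincomb (add , scal) {suc n} c e =
  trans (add _ _) (cong₂ _xor_ (scal (c zero) (e zero)) (linear-lincomb (add , scal) (c ∘ suc) (e ∘ suc)))

lookup-linear : ∀ {d} (k : Fin d) → IsLinear (λ x → lookup x k)
lookup-linear k = (λ x y → lookup-zipWith _xor_ k x y) , (λ c x → lookup-map k (c ∧_) x)

lookup-lincomb-ε : ∀ {d} (c : Fin d → Bool) k → lookup (lincomb c ε) k ≡ c k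
lookup-lincomb-ε c k =
  trans (linear-lincomb (lookup-linear k) c ε)
        (trans (parity-cong (λ i → cong (c i ∧_) (lookup∘tabulate _ k)))
               (parity-δ c _ k (dec-true (k ≟ k) refl) (λ i i≢k → dec-false (k ≟ i) (i≢k ∘ ≡.sym))))

lincomb-ε : ∀ {d} (x : Vect d) → lincomb (lookup x) ε ≡ x
lincomb-ε x = lookup-ext (lookup-lincomb-ε (lookup x))

dot-ε-ε : ∀ {d} (i j : Fin d) → dot (ε i) (ε j) ≡ does (j ≟ i)
dot-ε-ε i j = trans (dot-ε (ε i) j) (lookup∘tabulate _ j)

ε-orthonormal : ∀ d → ScalarProduct (dotForm d)
ε-orthonormal d =
  ε , ((λ x → lookup x , lincomb-ε x) , independent) ,
  (λ i j i≢j → trans (dot-ε-ε i j) (dec-false (j ≟ i) (i≢j ∘ ≡.sym))) ,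
  (λ i → trans (dot-ε-ε i i) (dec-true (i ≟ i) refl))
  where
  independent : ∀ c → lincomb c ε ≡ 𝟘 → ∀ i → c i ≡ false
  independent c c·ε≡𝟘 i =
    trans (≡.sym (lookup-lincomb-ε c i)) (trans (cong (λ x → lookup x i) c·ε≡𝟘) (lookup-replicate i false))

-- Symmetric bilinear forms and Gram matrices

module _ {d} (B : SymBilinear d) where

  φ-linearˡ : ∀ z → IsLinear (λ x → φ B x z)
  φ-linearˡ z = (λ x y → addˡ B x y z) , (λ c x → scalˡ B c x z)

  φ-linearʳ : ∀ z → IsLinear (φ B z)
  φ-linearʳ z =
    (λ x y → trans (symm B z (x ⊕ y)) (trans (addˡ B x y z) (cong₂ _xor_ (symm B x z) (symm B y z)))) ,
    (λ c x → trans (symm B z (c · x)) (trans (scalˡ B c x z) (cong (c ∧_) (symm B x z))))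

  φ-lincomb : ∀ {n n′} (c : Fin n → Bool) (e : Fin n → Vect d) (c′ : Fin n′ → Bool) (e′ : Fin n′ → Vect d) →
              φ B (lincomb c e) (lincomb c′ e′) ≡ parity (λ i → c i ∧ parity (λ j → c′ j ∧ φ B (e i) (e′ j)))
  φ-lincomb c e c′ e′ =
    trans (linear-lincomb (φ-linearˡ _) c e)
          (parity-cong (λ i → cong (c i ∧_) (linear-lincomb (φ-linearʳ (e i)) c′ e′)))

  -- Over F₂ the cross terms φ(x,y) + φ(y,x) in φ(x+y,x+y) cancel.
  diagonal-linear : IsLinear (λ x → φ B x x)
  diagonal-linear = add , scal
    where
    add : ∀ x y → φ B (x ⊕ y) (x ⊕ y) ≡ φ B x x xor φ B y y
    add x y = begin
      φ B (x ⊕ y) (x ⊕ y)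
        ≡⟨ addˡ B x y (x ⊕ y) ⟩
      φ B x (x ⊕ y) xor φ B y (x ⊕ y)
        ≡⟨ cong₂ _xor_ (proj₁ (φ-linearʳ x) x y) (proj₁ (φ-linearʳ y) x y) ⟩
      (φ B x x xor φ B x y) xor (φ B y x xor φ B y y)
        ≡⟨ cong (λ b → (φ B x x xor φ B x y) xor (b xor φ B y y)) (symm B y x) ⟩
      (φ B x x xor φ B x y) xor (φ B x y xor φ B y y)
        ≡⟨ solve 3 (λ a b c → (a :+ b) :+ (b :+ c) := a :+ c) refl (φ B x x) (φ B x y) (φ B y y) ⟩
      φ B x x xor φ B y y
        ∎
      where open ≡-Reasoning
    scal : ∀ c x → φ B (c · x) (c · x) ≡ c ∧ φ B x x
    scal c x = trans (scalˡ B c x (c · x))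
                     (trans (cong (c ∧_) (proj₂ (φ-linearʳ x) c x))
                            (trans (≡.sym (∧-assoc c c (φ B x x))) (cong (_∧ φ B x x) (∧-idem c))))

  φ-⊕·-⊕· : ∀ x a y b p q →
            φ B (x ⊕ (p · a)) (y ⊕ (q · b))
              ≡ ((φ B x y xor (q ∧ φ B x b)) xor (p ∧ φ B a y)) xor (p ∧ (q ∧ φ B a b))
  φ-⊕·-⊕· x a y b p q
    rewrite addˡ B x (p · a) (y ⊕ (q · b)) | scalˡ B p a (y ⊕ (q · b))
          | proj₁ (φ-linearʳ x) y (q · b) | proj₂ (φ-linearʳ x) q b
          | proj₁ (φ-linearʳ a) y (q · b) | proj₂ (φ-linearʳ a) q b
    = solve 6 (λ xy xb ay ab p q → (xy :+ q :* xb) :+ p :* (ay :+ q :* ab)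
                                   := ((xy :+ q :* xb) :+ p :* ay) :+ p :* (q :* ab))
              refl (φ B x y) (φ B x b) (φ B a y) (φ B a b) p q

  φ-anisotropic : ∀ {u x y} p q → φ B u u ≡ true → φ B x u ≡ false → φ B y u ≡ false →
                  φ B (x ⊕ (p · u)) (y ⊕ (q · u)) ≡ φ B x y xor (p ∧ q)
  φ-anisotropic {u} {x} {y} p q u·u x⊥u y⊥u
    rewrite φ-⊕·-⊕· x u y u p q | x⊥u | symm B u y | y⊥u | u·u
    = solve 3 (λ xy p q → ((xy :+ q :* con false) :+ p :* con false) :+ p :* (q :* con true) := xy :+ p :* q)
              refl (φ B x y) p q

  φ-hyperbolic : ∀ {a b x y} p q r s →
                 φ B a a ≡ false → φ B b b ≡ false → φ B a b ≡ true →
                 φ B x a ≡ false → φ B x b ≡ false → φ B y a ≡ false → φ B y b ≡ false →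
                 φ B ((x ⊕ (p · a)) ⊕ (q · b)) ((y ⊕ (r · a)) ⊕ (s · b)) ≡ (φ B x y xor (p ∧ s)) xor (q ∧ r)
  φ-hyperbolic {a} {b} {x} {y} p q r s a·a b·b a·b x⊥a x⊥b y⊥a y⊥b
    rewrite φ-⊕·-⊕· (x ⊕ (p · a)) b (y ⊕ (r · a)) b q s
          | φ-⊕·-⊕· x a y a p r | addˡ B x (p · a) b | scalˡ B p a b | symm B b (y ⊕ (r · a))
          | addˡ B y (r · a) b | scalˡ B r a b
          | x⊥a | x⊥b | symm B a y | y⊥a | y⊥b | a·a | b·b | a·b
    = solve 5 (λ xy p q r s →
                (((((xy :+ r :* con false) :+ p :* con false) :+ p :* (r :* con false))
                   :+ s :* (con false :+ p :* con true)) :+ q :* (con false :+ r :* con true))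
                   :+ q :* (s :* con false)
                := (xy :+ p :* s) :+ q :* r)
              refl (φ B x y) p q r s

Mat : ℕ → Set
Mat m = Fin m → Fin m → Bool

Symmetric : ∀ {m} → Mat m → Set
Symmetric M = ∀ i j → M i j ≡ M j i

ZeroDiagonal : ∀ {m} → Mat m → Set
ZeroDiagonal M = ∀ i → M i i ≡ false

Gram : ∀ {d} → SymBilinear d → Mat d
Gram B i j = φ B (ε i) (ε j)

Gram-symmetric : ∀ {d} (B : SymBilinear d) → Symmetric (Gram B)
Gram-symmetric B i j = symm B (ε i) (ε j)

φ-Gram : ∀ {d} (B : SymBilinear d) x y →
         φ B x y ≡ parity (λ i → lookup x i ∧ parity (λ j → lookup y j ∧ Gram B i j))
φ-Gram B x y = trans (≡.sym (cong₂ (φ B) (lincomb-ε x) (lincomb-ε y))) (φ-lincomb B (lookup x) ε (lookup y) ε)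

Gram-zeroDiagonal⇒alternating : ∀ {d} (B : SymBilinear d) → ZeroDiagonal (Gram B) → Alternating B
Gram-zeroDiagonal⇒alternating B diag x =
  trans (≡.sym (cong (λ y → φ B y y) (lincomb-ε x)))
        (trans (linear-lincomb (diagonal-linear B) (lookup x) ε)
               (parity-false (λ i → trans (cong (lookup x i ∧_) (diag i)) (∧-zeroʳ (lookup x i)))))

-- Realizing symmetric matrices as Gram matrices

Realization : ∀ {m} → ℕ → Mat m → Set
Realization {m} t M = Σ (Fin m → Vect t) λ w → ∀ i j → dot (w i) (w j) ≡ M i j

realization-≤ : ∀ {m t t′} {M : Mat m} → t ≤ t′ → Realization t M → Realization t′ M
realization-≤ t≤t′ = pad (≤⇒≤′ t≤t′)
  where
  pad : ∀ {m t t′} {M : Mat m} → t ≤′ t′ → Realization t M → Realization t′ M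
  pad ≤′-refl          r        = r
  pad (≤′-step t≤′t′) r with pad t≤′t′ r
  ... | w , gram = (λ i → false ∷ w i) , gram

realization-permute : ∀ {m t} {M : Mat m} (σ τ : Fin m → Fin m) → (∀ i → σ (τ i) ≡ i) →
                      Realization t (λ i j → M (σ i) (σ j)) → Realization t M
realization-permute {M = M} σ τ σ∘τ (w , gram) =
  (w ∘ τ) , λ i j → trans (gram (τ i) (τ j)) (cong₂ M (σ∘τ i) (σ∘τ j))

realization-zeroRow : ∀ {m t} {M : Mat (suc m)} → Symmetric M → (∀ j → M zero j ≡ false) →
                      Realization t (λ i j → M (suc i) (suc j)) → Realization t M
realization-zeroRow {m} {t} {M} M-sym row₀ (w , gram) = W , W-gram
  where
  W : Fin (suc m) → Vect t
  W zero    = 𝟘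
  W (suc i) = w i
  W-gram : ∀ i j → dot (W i) (W j) ≡ M i j
  W-gram zero    j       = trans (dot-comm 𝟘 (W j)) (trans (dot-𝟘ʳ (W j)) (≡.sym (row₀ j)))
  W-gram (suc i) zero    = trans (dot-𝟘ʳ (w i)) (≡.sym (trans (M-sym (suc i) zero) (row₀ (suc i))))
  W-gram (suc i) (suc j) = gram i j

realization-⊥𝟙 : ∀ {m t} {M : Mat m} → ZeroDiagonal M → ((w , _) : Realization t M) → ∀ i → dot (w i) 𝟙 ≡ false
realization-⊥𝟙 M-alt (w , gram) i = trans (dot-𝟙ʳ (w i)) (trans (gram i i) (M-alt i))

-- Schur complements of the pivot block [1], resp. of the hyperbolic block [[0,1],[1,0]]:
-- the Gram matrix of the remaining vectors once their components along the pivot vectors are removed.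
schur₁ : ∀ {m} → Mat (suc m) → Mat m
schur₁ M i j = M (suc i) (suc j) xor (M (suc i) zero ∧ M (suc j) zero)

schur₂ : ∀ {m} → Mat (suc (suc m)) → Mat m
schur₂ M i j = (M (suc (suc i)) (suc (suc j)) xor (M (suc (suc i)) zero ∧ M (suc (suc j)) (suc zero)))
                 xor (M (suc (suc i)) (suc zero) ∧ M (suc (suc j)) zero)

schur₁-symmetric : ∀ {m} {M : Mat (suc m)} → Symmetric M → Symmetric (schur₁ M)
schur₁-symmetric {M = M} M-sym i j =
  cong₂ _xor_ (M-sym (suc i) (suc j)) (∧-comm (M (suc i) zero) (M (suc j) zero))

schur₂-symmetric : ∀ {m} {M : Mat (suc (suc m))} → Symmetric M → Symmetric (schur₂ M)
schur₂-symmetric {M = M} M-sym i j rewrite M-sym (suc (suc i)) (suc (suc j)) =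
  solve 5 (λ m a b c d → (m :+ a :* b) :+ c :* d := (m :+ d :* c) :+ b :* a) refl
          (M (suc (suc j)) (suc (suc i))) (M (suc (suc i)) zero) (M (suc (suc j)) (suc zero))
          (M (suc (suc i)) (suc zero)) (M (suc (suc j)) zero)

schur₂-zeroDiagonal : ∀ {m} {M : Mat (suc (suc m))} → ZeroDiagonal M → ZeroDiagonal (schur₂ M)
schur₂-zeroDiagonal {M = M} M-alt i rewrite M-alt (suc (suc i)) =
  solve 2 (λ a b → a :* b :+ b :* a := con false) refl (M (suc (suc i)) zero) (M (suc (suc i)) (suc zero))

-- Wᵢ = w₀ᵢ + Mᵢ₀·u with w₀ = (𝟘, w), so that the pivot row needs no separate formula: W₀ = u.
extend-schur₁ : ∀ {m t} {M : Mat (suc m)} → Symmetric M → M zero zero ≡ true →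
                {u : Vect t} → dot u u ≡ true →
                ((w , _) : Realization t (schur₁ M)) → (∀ i → dot (w i) u ≡ false) → Realization t M
extend-schur₁ {m} {t} {M} M-sym pivot {u} u·u (w , gram) w⊥u = W , λ i j →
  trans (φ-anisotropic (dotForm t) {u} {w₀ i} {w₀ j} (M i zero) (M j zero) u·u (w₀⊥u i) (w₀⊥u j)) (entry i j)
  where
  w₀ : Fin (suc m) → Vect t
  w₀ zero    = 𝟘
  w₀ (suc i) = w i

  W : Fin (suc m) → Vect t
  W i = w₀ i ⊕ (M i zero · u)

  w₀⊥u : ∀ i → dot (w₀ i) u ≡ false
  w₀⊥u zero    = trans (dot-comm 𝟘 u) (dot-𝟘ʳ u)
  w₀⊥u (suc i) = w⊥u i

  entry : ∀ i j → dot (w₀ i) (w₀ j) xor (M i zero ∧ M j zero) ≡ M i j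
  entry zero    j       rewrite dot-comm 𝟘 (w₀ j) | dot-𝟘ʳ (w₀ j) | pivot = M-sym j zero
  entry (suc i) zero    rewrite pivot | dot-𝟘ʳ (w i) = ∧-identityʳ (M (suc i) zero)
  entry (suc i) (suc j) rewrite gram i j =
    solve 3 (λ m a b → (m :+ a :* b) :+ a :* b := m) refl (M (suc i) (suc j)) (M (suc i) zero) (M (suc j) zero)

extend-schur₂ : ∀ {m t} {M : Mat (suc (suc m))} → Symmetric M → ZeroDiagonal M → M zero (suc zero) ≡ true →
                {a b : Vect t} → dot a a ≡ false → dot b b ≡ false → dot a b ≡ true →
                ((w , _) : Realization t (schur₂ M)) →
                (∀ i → dot (w i) a ≡ false) → (∀ i → dot (w i) b ≡ false) → Realization t M
extend-schur₂ {m} {t} {M} M-sym M-alt pair {a} {b} a·a b·b a·b (w , gram) w⊥a w⊥b = W , λ i j →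
  trans (φ-hyperbolic (dotForm t) {a} {b} {w₀ i} {w₀ j} (M i (suc zero)) (M i zero) (M j (suc zero)) (M j zero)
                                  a·a b·b a·b (w₀⊥ a w⊥a i) (w₀⊥ b w⊥b i) (w₀⊥ a w⊥a j) (w₀⊥ b w⊥b j))
        (entry i j)
  where
  w₀ : Fin (suc (suc m)) → Vect t
  w₀ zero          = 𝟘
  w₀ (suc zero)    = 𝟘
  w₀ (suc (suc i)) = w i

  W : Fin (suc (suc m)) → Vect t
  W i = (w₀ i ⊕ (M i (suc zero) · a)) ⊕ (M i zero · b)

  w₀⊥ : ∀ c → (∀ i → dot (w i) c ≡ false) → ∀ i → dot (w₀ i) c ≡ false
  w₀⊥ c w⊥c zero          = trans (dot-comm 𝟘 c) (dot-𝟘ʳ c)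
  w₀⊥ c w⊥c (suc zero)    = trans (dot-comm 𝟘 c) (dot-𝟘ʳ c)
  w₀⊥ c w⊥c (suc (suc i)) = w⊥c i

  pair′ : M (suc zero) zero ≡ true
  pair′ = trans (M-sym (suc zero) zero) pair

  entry : ∀ i j → (dot (w₀ i) (w₀ j) xor (M i (suc zero) ∧ M j zero)) xor (M i zero ∧ M j (suc zero)) ≡ M i j
  entry zero j
    rewrite dot-comm 𝟘 (w₀ j) | dot-𝟘ʳ (w₀ j) | M-alt zero | pair = trans (xor-identityʳ _) (M-sym j zero)
  entry (suc zero) j
    rewrite dot-comm 𝟘 (w₀ j) | dot-𝟘ʳ (w₀ j) | M-alt (suc zero) | pair′ = M-sym j (suc zero)
  entry (suc (suc i)) zero
    rewrite dot-𝟘ʳ (w i) | M-alt zero | pair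
          | ∧-zeroʳ (M (suc (suc i)) (suc zero)) | ∧-identityʳ (M (suc (suc i)) zero) = refl
  entry (suc (suc i)) (suc zero)
    rewrite dot-𝟘ʳ (w i) | M-alt (suc zero) | pair′
          | ∧-identityʳ (M (suc (suc i)) (suc zero)) | ∧-zeroʳ (M (suc (suc i)) zero) =
      xor-identityʳ _
  entry (suc (suc i)) (suc (suc j))
    rewrite gram i j =
      solve 5 (λ m a b c d → ((m :+ a :* b) :+ c :* d) :+ c :* d :+ a :* b := m) refl
              (M (suc (suc i)) (suc (suc j))) (M (suc (suc i)) zero) (M (suc (suc j)) (suc zero))
              (M (suc (suc i)) (suc zero)) (M (suc (suc j)) zero)

oddCeil : ℕ → ℕ
oddCeil zero          = 1
oddCeil (suc zero)    = 1
oddCeil (suc (suc m)) = suc (suc (oddCeil m))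

dot-𝟙-oddCeil : ∀ m → dot (𝟙 {oddCeil m}) 𝟙 ≡ true
dot-𝟙-oddCeil zero          = refl
dot-𝟙-oddCeil (suc zero)    = refl
dot-𝟙-oddCeil (suc (suc m)) rewrite dot-𝟙-oddCeil m = refl

oddCeil≤suc : ∀ m → oddCeil m ≤ suc m
oddCeil≤suc zero          = s≤s z≤n
oddCeil≤suc (suc zero)    = s≤s z≤n
oddCeil≤suc (suc (suc m)) = s≤s (s≤s (oddCeil≤suc m))

oddCeil-suc≤ : ∀ m → oddCeil (suc m) ≤ suc (suc (oddCeil m))
oddCeil-suc≤ zero          = s≤s z≤n
oddCeil-suc≤ (suc zero)    = ≤-refl
oddCeil-suc≤ (suc (suc m)) = s≤s (s≤s (oddCeil-suc≤ m))

extend-hyperbolic : ∀ {m} {M : Mat (suc (suc m))} → Symmetric M → ZeroDiagonal M → M zero (suc zero) ≡ true →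
                    Realization (oddCeil m) (schur₂ M) → Realization (suc (suc (oddCeil m))) M
extend-hyperbolic {m} {M} M-sym M-alt pair (w , gram) =
  extend-schur₂ M-sym M-alt pair {a = true ∷ false ∷ 𝟙} {b = false ∷ true ∷ 𝟙} a·a b·b (dot-𝟙-oddCeil m)
    ((λ i → false ∷ false ∷ w i) , gram) w⊥𝟙 w⊥𝟙
  where
  w⊥𝟙 = realization-⊥𝟙 (schur₂-zeroDiagonal {M = M} M-alt) (w , gram)
  a·a : dot (true ∷ false ∷ 𝟙 {oddCeil m}) (true ∷ false ∷ 𝟙) ≡ false
  a·a rewrite dot-𝟙-oddCeil m = refl
  b·b : dot (false ∷ true ∷ 𝟙 {oddCeil m}) (false ∷ true ∷ 𝟙) ≡ false
  b·b rewrite dot-𝟙-oddCeil m = refl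

realize-alternating : ∀ m (M : Mat m) → Symmetric M → ZeroDiagonal M → Realization (oddCeil m) M
realize-alternating zero          M _     _     = (λ ()) , λ ()
realize-alternating (suc zero)    M _     M-alt = (λ _ → 𝟘) , λ { zero zero → ≡.sym (M-alt zero) }
realize-alternating (suc (suc m)) M M-sym M-alt =
  [ pivot
  , (λ row₀ → realization-zeroRow M-sym row₀
                (realization-≤ (oddCeil-suc≤ m)
                  (realize-alternating (suc m) _ (λ i j → M-sym (suc i) (suc j)) (M-alt ∘ suc))))
  ]′ (∃true⊎∀false (M zero))
  where
  pivot : ∃ (λ j → M zero j ≡ true) → Realization (oddCeil (suc (suc m))) M
  pivot (zero  , M₀₀) = contradiction (trans (≡.sym M₀₀) (M-alt zero)) λ ()
  pivot (suc j , M₀ⱼ) =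
    realization-permute σ (transpose (suc j) (suc zero)) (λ _ → transpose-inverse (suc zero) (suc j))
      (extend-hyperbolic {M = M′} M′-sym (M-alt ∘ σ) M₀ⱼ
        (realize-alternating m (schur₂ M′) (schur₂-symmetric {M = M′} M′-sym)
                                           (schur₂-zeroDiagonal {M = M′} (M-alt ∘ σ))))
    where
    σ : Fin (suc (suc m)) → Fin (suc (suc m))
    σ = transpose (suc zero) (suc j)
    M′ : Mat (suc (suc m))
    M′ a b = M (σ a) (σ b)
    M′-sym : Symmetric M′
    M′-sym a b = M-sym (σ a) (σ b)

realize-nonalternating : ∀ m (M : Mat m) → Symmetric M → (∃ λ k → M k k ≡ true) → Realization m M
realize-nonalternating (suc m) M M-sym (k , M₍kk₎) =
  realization-permute σ (transpose k zero) (λ _ → transpose-inverse zero k)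
    ([ fresh , reuse𝟙 ]′ (∃true⊎∀false (λ i → schur₁ M′ i i)))
  where
  σ : Fin (suc m) → Fin (suc m)
  σ = transpose zero k
  M′ : Mat (suc m)
  M′ a b = M (σ a) (σ b)
  M′-sym : Symmetric M′
  M′-sym a b = M-sym (σ a) (σ b)

  fresh : (∃ λ i → schur₁ M′ i i ≡ true) → Realization (suc m) M′
  fresh q with realize-nonalternating m (schur₁ M′) (schur₁-symmetric {M = M′} M′-sym) q
  ... | w , gram = extend-schur₁ M′-sym M₍kk₎ {u = true ∷ 𝟘} (cong not (dot-𝟘ʳ (𝟘 {m})))
                     ((λ i → false ∷ w i) , gram) (λ i → dot-𝟘ʳ (w i))

  reuse𝟙 : ZeroDiagonal (schur₁ M′) → Realization (suc m) M′
  reuse𝟙 alt =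
    realization-≤ (oddCeil≤suc m)
      (extend-schur₁ M′-sym M₍kk₎ {u = 𝟙} (dot-𝟙-oddCeil m) r (realization-⊥𝟙 alt r))
    where r = realize-alternating m (schur₁ M′) (schur₁-symmetric {M = M′} M′-sym) alt

realize : ∀ d (M : Mat d) → Symmetric M → Realization (suc d) M
realize d M M-sym =
  [ (λ q → realization-≤ (n≤1+n d) (realize-nonalternating d M M-sym q))
  , (λ alt → realization-≤ (oddCeil≤suc d) (realize-alternating d M M-sym alt))
  ]′ (∃true⊎∀false (λ k → M k k))

-- Comparing the representations

module _ (G : Graph) where

  isometry⇒boolRep : ∀ {d t} ((B , f , _) : HasGeoRep G d) (g : V G → Vect t) →
                     (∀ u v → dot (g u) (g v) ≡ φ B (f u) (f v)) → HasBoolRep G t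
  isometry⇒boolRep (B , f , rep) g isometry =
    (λ k u → lookup (g u) k) ,
    λ u v u≢v → subst (λ b → E G u v ⇔ (b ≡ true)) (≡.sym (isometry u v)) (rep u v u≢v)

  boolRep⇒innerRep : ∀ {n} → HasBoolRep G n → HasInnerRep G n
  boolRep⇒innerRep {n} (C , rep) = dotForm n , ε-orthonormal n , f , f-rep
    where
    f : V G → Vect n
    f u = tabulate (λ i → C i u)
    f-rep : GeoRep G (dotForm n) f
    f-rep u v u≢v rewrite dot-tabulate (λ i → C i u) (λ i → C i v) = rep u v u≢v

  innerRep⇒boolRep : ∀ {n} → HasInnerRep G n → HasBoolRep G n
  innerRep⇒boolRep {n} (B , (e , (span , _) , orthogonal , normal) , f , rep) =
    isometry⇒boolRep (B , f , rep) (λ u → tabulate (coord (f u))) coord-isometry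
    where
    coord : Vect n → Fin n → Bool
    coord x = proj₁ (span x)
    φ-coord : ∀ x y → φ B x y ≡ parity (λ i → coord x i ∧ coord y i)
    φ-coord x y =
      trans (≡.sym (cong₂ (φ B) (proj₂ (span x)) (proj₂ (span y))))
            (trans (φ-lincomb B (coord x) e (coord y) e)
                   (parity-cong λ i → cong (coord x i ∧_)
                     (parity-δ (coord y) _ i (normal i) (λ j j≢i → orthogonal i j (j≢i ∘ ≡.sym)))))
    coord-isometry : ∀ u v → dot (tabulate (coord (f u))) (tabulate (coord (f v))) ≡ φ B (f u) (f v)
    coord-isometry u v = trans (dot-tabulate (coord (f u)) (coord (f v))) (≡.sym (φ-coord (f u) (f v)))

  realization⇒boolRep : ∀ {d t} → ((B , _) : HasGeoRep G d) → Realization t (Gram B) → HasBoolRep G t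
  realization⇒boolRep {d} {t} geo@(B , f , _) (w , gram) =
    isometry⇒boolRep geo (g ∘ f) (λ u v → isometry (f u) (f v))
    where
    g : Vect d → Vect t
    g x = lincomb (lookup x) w
    isometry : ∀ x y → dot (g x) (g y) ≡ φ B x y
    isometry x y =
      trans (φ-lincomb (dotForm t) (lookup x) w (lookup y) w)
            (trans (parity-cong λ i → cong (lookup x i ∧_) (parity-cong λ j → cong (lookup y j ∧_) (gram i j)))
                   (≡.sym (φ-Gram B x y)))

  geoRep⇒boolRep-suc : ∀ {d} → HasGeoRep G d → HasBoolRep G (suc d)
  geoRep⇒boolRep-suc {d} geo@(B , _) = realization⇒boolRep geo (realize d (Gram B) (Gram-symmetric B))

  geoRep⇒boolRep⊎sympRep : ∀ {d} → HasGeoRep G d → HasBoolRep G d ⊎ HasSympRep G d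
  geoRep⇒boolRep⊎sympRep {d} geo@(B , f , rep) =
    [ (λ q → inj₁ (realization⇒boolRep geo (realize-nonalternating d (Gram B) (Gram-symmetric B) q)))
    , (λ alt → inj₂ (B , Gram-zeroDiagonal⇒alternating B alt , f , rep))
    ]′ (∃true⊎∀false (λ k → Gram B k k))

  boolRep⇒geoRep : ∀ {n} → HasBoolRep G n → HasGeoRep G n
  boolRep⇒geoRep bool with boolRep⇒innerRep bool
  ... | B , _ , f , rep = B , f , rep

  sympRep⇒geoRep : ∀ {n} → HasSympRep G n → HasGeoRep G n
  sympRep⇒geoRep (B , _ , f , rep) = B , f , rep

-- Complete graphs

Vec-Bool↔Fin : ∀ n → Vec Bool n ↔ Fin (2 ^ n)
Vec-Bool↔Fin zero    = mk↔ₛ′ (λ _ → zero) (λ _ → []) (λ { zero → refl }) (λ { [] → refl })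
Vec-Bool↔Fin (suc n) = ↔-sym *↔× ↔-∘ ((↔-sym 2↔Bool ×-↔ Vec-Bool↔Fin n) ↔-∘ uncons↔)
  where
  uncons↔ : Vec Bool (suc n) ↔ (Bool × Vec Bool n)
  uncons↔ = mk↔ₛ′ uncons (uncurry _∷_) (λ _ → refl) (λ { (_ ∷ _) → refl })

Vec-Bool-↣⇒≤ : ∀ {m d} → Vec Bool m ↣ Vec Bool d → m ≤ d
Vec-Bool-↣⇒≤ {m} {d} F =
  ≮⇒≥ λ d<m → <⇒≱ (^-monoʳ-< 2 (s≤s (s≤s z≤n)) d<m) (injective⇒≤ (Injection.injective 2^m↣2^d))
  where
  2^m↣2^d : Fin (2 ^ m) ↣ Fin (2 ^ d)
  2^m↣2^d = ↔⇒↣ (Vec-Bool↔Fin d) ↣-∘ (F ↣-∘ ↔⇒↣ (↔-sym (Vec-Bool↔Fin m)))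

K : ℕ → Graph
K m = record { V = Fin m ; E = _≢_ ; sym = λ i≢j → i≢j ∘ ≡.sym ; irrefl = λ i≢i → i≢i refl }

φ-Vect₀ : (B : SymBilinear 0) → ∀ x y → φ B x y ≡ false
φ-Vect₀ B [] [] = scalˡ B false [] []

edge⇒¬geoRep₀ : ∀ (G : Graph) {u v} → E G u v → ¬ HasGeoRep G 0
edge⇒¬geoRep₀ G {u} {v} uv (B , f , rep) =
  contradiction (trans (≡.sym (Equivalence.to (rep u v u≢v) uv)) (φ-Vect₀ B (f u) (f v))) λ ()
  where
  u≢v : u ≢ v
  u≢v refl = irrefl G uv

K-boolDim : ∀ n → IsBoolDim (K (suc (suc n))) 1
K-boolDim n = ((λ _ _ → true) , λ u v u≢v → mk⇔ (λ _ → refl) (λ _ → u≢v)) , λ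
  { zero    _         bool → edge⇒¬geoRep₀ (K _) {zero} {suc zero} (λ ()) (boolRep⇒geoRep (K _) bool)
  ; (suc m) (s≤s ()) _
  }

-- Its Gram matrix is J − I: all entries 1 except the zero diagonal.
JForm : ∀ d → SymBilinear d
JForm d = record
  { φ     = λ x y → (dot 𝟙 x ∧ dot 𝟙 y) xor dot x y
  ; addˡ  = λ x y z → trans (cong₂ (λ a b → (a ∧ dot 𝟙 z) xor b) (ℓ-add x y) (dot-⊕ˡ x y z))
              (solve 5 (λ a b c p q → (a :+ b) :* c :+ (p :+ q) := (a :* c :+ p) :+ (b :* c :+ q)) refl
                       (dot 𝟙 x) (dot 𝟙 y) (dot 𝟙 z) (dot x z) (dot y z))
  ; scalˡ = λ c x z → trans (cong₂ (λ a b → (a ∧ dot 𝟙 z) xor b) (ℓ-scal c x) (dot-·ˡ c x z))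
              (solve 4 (λ c a b p → (c :* a) :* b :+ c :* p := c :* (a :* b :+ p)) refl
                       c (dot 𝟙 x) (dot 𝟙 z) (dot x z))
  ; symm  = λ x y → cong₂ _xor_ (∧-comm (dot 𝟙 x) (dot 𝟙 y)) (dot-comm x y)
  }
  where
  ℓ-add = proj₁ (φ-linearʳ (dotForm d) 𝟙)
  ℓ-scal = proj₂ (φ-linearʳ (dotForm d) 𝟙)

JForm-alternating : ∀ d → Alternating (JForm d)
JForm-alternating d x rewrite dot-comm 𝟙 x | dot-𝟙ʳ x | ∧-idem (dot x x) = xor-same (dot x x)

K-sympRep : ∀ m → HasSympRep (K m) m
K-sympRep m = JForm m , JForm-alternating m , ε , λ i j i≢j → mk⇔ (λ _ → adjacent i j i≢j) (λ _ → i≢j)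
  where
  adjacent : ∀ i j → i ≢ j → φ (JForm m) (ε i) (ε j) ≡ true
  adjacent i j i≢j
    rewrite dot-comm 𝟙 (ε i) | dot-comm 𝟙 (ε j) | dot-ε-ε i j | dec-false (j ≟ i) (i≢j ∘ ≡.sym)
          | dot-𝟙ʳ (ε i) | dot-𝟙ʳ (ε j) | dot-ε-ε i i | dot-ε-ε j j
          | dec-true (i ≟ i) refl | dec-true (j ≟ j) refl = refl

module _ {d k} (B : SymBilinear d) (alt : Alternating B) (v : Fin (k * 2) → Vect d)
         (adjacent : ∀ i j → i ≢ j → φ B (v i) (v j) ≡ true) where

  φ-v : ∀ i j → φ B (v i) (v j) ≡ not (does (i ≟ j))
  φ-v i j with i ≟ j
  ... | yes refl = alt (v i)
  ... | no  i≢j  = adjacent i j i≢j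

  φ-lincomb-v : ∀ (c : Fin (k * 2) → Bool) j → φ B (lincomb c v) (v j) ≡ parity c xor c j
  φ-lincomb-v c j = begin
    φ B (lincomb c v) (v j)                          ≡⟨ linear-lincomb (φ-linearˡ B (v j)) c v ⟩
    parity (λ i → c i ∧ φ B (v i) (v j))             ≡⟨ parity-cong (λ i → cong (c i ∧_) (φ-v i j)) ⟩
    parity (λ i → c i ∧ not (does (i ≟ j)))          ≡⟨ parity-cong (λ i → ∧-not (c i) (does (i ≟ j))) ⟩
    parity (λ i → c i xor (c i ∧ does (i ≟ j)))      ≡⟨ parity-xor c _ ⟩
    parity c xor parity (λ i → c i ∧ does (i ≟ j))   ≡⟨ cong (parity c xor_) δ-sum ⟩
    parity c xor c j                                 ∎
    where
    open ≡-Reasoning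
    ∧-not : ∀ a b → a ∧ not b ≡ a xor (a ∧ b)
    ∧-not false b = refl
    ∧-not true  b = refl
    δ-sum : parity (λ i → c i ∧ does (i ≟ j)) ≡ c j
    δ-sum = parity-δ c _ j (dec-true (j ≟ j) refl) (λ i → dec-false (i ≟ j))

  -- The Gram matrix J - I of the vᵢ is invertible because k * 2 is even: if Σ cᵢ vᵢ is
  -- paired with every vⱼ, all cⱼ equal the parity of c, which then must vanish.
  lincomb-v-injective : ∀ x y → lincomb (lookup x) v ≡ lincomb (lookup y) v → x ≡ y
  lincomb-v-injective x y eq = lookup-ext λ j → xor≡false⇒≡ (trans (diff j) δ≡false)
    where
    δ : Bool
    δ = parity (lookup x) xor parity (lookup y)
    diff : ∀ j → lookup x j xor lookup y j ≡ δ
    diff j =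
      swap (parity (lookup x)) (lookup x j) (parity (lookup y)) (lookup y j)
        (trans (≡.sym (φ-lincomb-v (lookup x) j))
               (trans (cong (λ z → φ B z (v j)) eq) (φ-lincomb-v (lookup y) j)))
      where
      swap : ∀ p a q b → p xor a ≡ q xor b → a xor b ≡ p xor q
      swap p a q b e = begin
        a xor b                   ≡⟨ solve 3 (λ p a b → a :+ b := (p :+ a) :+ (p :+ b)) refl p a b ⟩
        (p xor a) xor (p xor b)   ≡⟨ cong (_xor (p xor b)) e ⟩
        (q xor b) xor (p xor b)   ≡⟨ solve 3 (λ p q b → (q :+ b) :+ (p :+ b) := p :+ q) refl p q b ⟩
        p xor q                   ∎
        where open ≡-Reasoning
    δ≡false : δ ≡ false
    δ≡false = begin
      δ                                          ≡⟨ ≡.sym (parity-xor (lookup x) (lookup y)) ⟩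
      parity (λ j → lookup x j xor lookup y j)   ≡⟨ parity-cong diff ⟩
      parity {k * 2} (λ _ → δ)                   ≡⟨ parity-even k δ ⟩
      false                                      ∎
      where open ≡-Reasoning
    xor≡false⇒≡ : ∀ {a b} → a xor b ≡ false → a ≡ b
    xor≡false⇒≡ {false} {false} _ = refl
    xor≡false⇒≡ {true}  {true}  _ = refl

  even-adjacent⇒≤ : k * 2 ≤ d
  even-adjacent⇒≤ = Vec-Bool-↣⇒≤ (mk↣ {to = λ x → lincomb (lookup x) v} (lincomb-v-injective _ _))

K-sympRep⇒≤ : ∀ k {d} → HasSympRep (K (k * 2)) d → k * 2 ≤ d
K-sympRep⇒≤ k (B , alt , v , rep) =
  even-adjacent⇒≤ {k = k} B alt v (λ i j i≢j → Equivalence.to (rep i j i≢j) i≢j)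

-- The three cases

module _ (G : Graph) {n} (boolDim : IsBoolDim G n) where

  boolDim⇒innerDim : IsInnerDim G n
  boolDim⇒innerDim =
    boolRep⇒innerRep G (proj₁ boolDim) , λ m m<n inner → proj₂ boolDim m m<n (innerRep⇒boolRep G inner)

  geoRep⇒≤suc : ∀ {m} → HasGeoRep G m → n ≤ suc m
  geoRep⇒≤suc {m} geo = ≮⇒≥ λ 1+m<n → proj₂ boolDim (suc m) 1+m<n (geoRep⇒boolRep-suc G geo)

  geoRep-pred⇒case2 : ∀ {m} → suc m ≡ n → HasGeoRep G m → Case2 G n
  geoRep-pred⇒case2 {m} refl geo =
    m , refl , (geo , noGeo) , (symp , λ k k<m s → noGeo k k<m (sympRep⇒geoRep G s))
    where
    noGeo : ∀ k → k < m → ¬ HasGeoRep G k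
    noGeo k k<m geo′ = <⇒≱ k<m (≤-pred (geoRep⇒≤suc geo′))
    symp : HasSympRep G m
    symp = [ (λ bool → contradiction bool (proj₂ boolDim m ≤-refl)) , id ]′ (geoRep⇒boolRep⊎sympRep G geo)

module _ (lem : ExcludedMiddle 0ℓ) (G : Graph) {n : ℕ} where

  geoDim⇒case1⊎case3 : IsGeoDim G n → Case1 G n ⊎ Case3 G n
  geoDim⇒case1⊎case3 geoDim@(_ , minimal) with lem {HasSympRep G n}
  ... | yes symp = inj₁ (geoDim , symp , λ k k<n s → minimal k k<n (sympRep⇒geoRep G s))
  ... | no ¬symp = inj₂ (geoDim , λ k k≤n s →
        [ (λ k<n → minimal k k<n (sympRep⇒geoRep G s)) , (λ { refl → ¬symp s }) ]′ (m≤n⇒m<n∨m≡n k≤n))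

  trichotomy : IsBoolDim G n → Case1 G n ⊎ Case2 G n ⊎ Case3 G n
  trichotomy boolDim with lem {∃ λ m → suc m ≡ n × HasGeoRep G m}
  ... | yes (m , 1+m≡n , geo) = inj₂ (inj₁ (geoRep-pred⇒case2 G boolDim 1+m≡n geo))
  ... | no  ¬geo-pred =
    [ inj₁ , inj₂ ∘ inj₂ ]′ (geoDim⇒case1⊎case3
      (boolRep⇒geoRep G (proj₁ boolDim) ,
       λ k k<n geo → ¬geo-pred (k , ≤-antisym k<n (geoRep⇒≤suc G boolDim geo) , geo)))

case2⇒¬geoDim : ∀ (G : Graph) {n} → Case2 G n → ¬ IsGeoDim G n
case2⇒¬geoDim G (m , refl , (geo , _) , _) (_ , minimal) = minimal m ≤-refl geo

cases-exclusive : ∀ (G : Graph) n →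
                  ¬ (Case1 G n × Case2 G n) × ¬ (Case1 G n × Case3 G n) × ¬ (Case2 G n × Case3 G n)
cases-exclusive G n =
  (λ (case1 , case2) → case2⇒¬geoDim G case2 (proj₁ case1)) ,
  (λ ((_ , symp) , (_ , ¬symp)) → ¬symp n ≤-refl (proj₁ symp)) ,
  (λ (case2 , case3) → case2⇒¬geoDim G case2 (proj₁ case3))

K-case3 : ∀ N → IsBoolDim (K (suc N * 2)) 1 × Case3 (K (suc N * 2)) 1 × IsSympDim (K (suc N * 2)) (suc N * 2)
K-case3 N = boolDim , (geoDim , λ k k≤1 s → <⇒≱ (s≤s (s≤s z≤n)) (≤-trans (K-sympRep⇒≤ (suc N) s) k≤1)) ,
            (K-sympRep _ , λ k k<2N s → <⇒≱ k<2N (K-sympRep⇒≤ (suc N) s))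
  where
  boolDim = K-boolDim (N * 2)
  geoDim : IsGeoDim (K (suc N * 2)) 1
  geoDim = boolRep⇒geoRep (K _) (proj₁ boolDim) ,
           λ { zero _ → edge⇒¬geoRep₀ (K _) {zero} {suc zero} (λ ()) ; (suc m) (s≤s ()) }

mainTheorem7 :
    (ExcludedMiddle 0ℓ →
      ∀ (G : Graph) (n : ℕ) → IsBoolDim G n →
        IsInnerDim G n × ExactlyOneOf (Case1 G n) (Case2 G n) (Case3 G n))
    ×
    (∀ (N : ℕ) → Σ Graph λ G → Σ ℕ λ n → Σ ℕ λ s →
        IsBoolDim G n × Case3 G n × IsSympDim G s × n + N ≤ s)
mainTheorem7 =
  (λ lem G n boolDim → boolDim⇒innerDim G boolDim , trichotomy lem G boolDim , cases-exclusive G n) ,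
  λ N → let boolDim , case3 , sympDim = K-case3 N in
        K (suc N * 2) , 1 , suc N * 2 , boolDim , case3 , sympDim , m≤m*n (suc N) 2
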